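{- Let $\lambda_1,\lambda_2$ be hook-shaped partitions of $n$. Then the diagonal action of $C_n$ on $\mathrm{SYT}(\lambda_1)\times\mathrm{SYT}(\lambda_2)$ has exactly $\min(r_1(\lambda_1),c_1(\lambda_1),r_1(\lambda_2),c_1(\lambda_2))$ orbits.
   Context: A partition is identified with its Young diagram (boxes $(i,j)$, row $i$, column $j$); $r_1(\lambda)$ is the number of boxes in the first row and $c_1(\lambda)$ the number of boxes in the first column. $\lambda$ is hook-shaped if its diagram does not contain the box $(2,2)$. $\mathrm{SYT}(\lambda)$ is the set of standard Young tableaux of shape $\lambda$ (fillings by $1,\dots,n$ increasing along rows and down columns). The cactus group $C_n$ (generators $s_{[i,j]}$, $1\le i<j\le n$, relations $s_{[i,j]}^2=1$; $s_{[i,j]}s_{[k,l]}=s_{[k,l]}s_{[i,j]}$ for disjoint intervals; $s_{[i,j]}s_{[k,l]}s_{[i,j]}=s_{[i+j-l,i+j-k]}$ for $[k,l]\subseteq[i,j]$) acts on each $\mathrm{SYT}(\lambda)$, $\lambda\vdash n$, with $s_{[1,j]}$ acting as the Schützenberger involution of the subtableau of entries $1,\dots,j$; its image equals the group generated by the Bender–Knuth involutions $t_i$ ($t_i$ swaps $i$ and $i+1$ if the result is standard, else does nothing). -}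

module Defs where

open import Data.Nat using (ℕ; zero; suc; _+_; _∸_; _≤_; _<_; _<ᵇ_; _⊓_; _≟_)
open import Data.Nat.Properties using ()
open import Data.Bool using (if_then_else_)
open import Data.Fin using (Fin; toℕ) renaming (zero to fzero; suc to fsuc)
open import Data.List using (List; []; _∷_; length; take; drop; _++_; lookup)
open import Data.Nat.ListAction using (sum)
open import Data.List.Relation.Unary.All using (All)
open import Data.List.Relation.Unary.Linked using (Linked)
open import Data.Vec as Vec using (Vec; []; _∷_; _∷ʳ_; _[_]≔_)
open import Data.Maybe using (Maybe; just; nothing)
import Data.Maybe as Maybe
open import Data.Product using (Σ; ∃; _×_; _,_; proj₁; proj₂)
open import Data.Product.Properties using (≡-dec)
open import Relation.Nullary using (yes; no; ¬_)
open import Relation.Binary.PropositionalEquality using (_≡_)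
open import Relation.Binary.Construct.Closure.ReflexiveTransitive using (Star)

-- Partitions and Young diagrams (cells 0-indexed: (row , column))

Cell : Set
Cell = ℕ × ℕ

IsPartition : ℕ → List ℕ → Set
IsPartition n lam = Linked (λ a b → b ≤ a) lam × All (λ a → 1 ≤ a) lam × sum lam ≡ n

rowLen : List ℕ → ℕ → ℕ
rowLen [] r = 0
rowLen (x ∷ xs) zero = x
rowLen (x ∷ xs) (suc r) = rowLen xs r

InDiagram : List ℕ → Cell → Set
InDiagram lam (r , c) = c < rowLen lam r

r₁ : List ℕ → ℕ
r₁ lam = rowLen lam 0

c₁ : List ℕ → ℕ
c₁ lam = length lam

-- hook-shaped: diagram does not contain the box (2,2) (1-indexed) = (1 , 1) (0-indexed)
IsHook : List ℕ → Set
IsHook lam = ¬ InDiagram lam (1 , 1)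

-- Standard Young tableaux.  A tableau with entries 1..n is encoded as the
-- list T of length n whose a-th element (0-indexed) is the cell containing
-- the entry a+1.

row col : Cell → ℕ
row = proj₁
col = proj₂

IsStandardFilling : List Cell → Set
IsStandardFilling T =
  ∀ (a b : Fin (length T)) →
    (row (lookup T a) ≡ row (lookup T b) → col (lookup T a) < col (lookup T b) → toℕ a < toℕ b)
  × (col (lookup T a) ≡ col (lookup T b) → row (lookup T a) < row (lookup T b) → toℕ a < toℕ b)

IsSYT : List ℕ → ℕ → List Cell → Set
IsSYT lam n T =
    length T ≡ n
  × (∀ a → InDiagram lam (lookup T a))
  × (∀ a b → lookup T a ≡ lookup T b → a ≡ b)
  × (∀ x → InDiagram lam x → ∃ λ a → lookup T a ≡ x)
  × IsStandardFilling T

SYT : List ℕ → ℕ → Set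
SYT lam n = Σ (List Cell) (IsSYT lam n)

findCell : ∀ {k} → Cell → Vec Cell k → Maybe (Fin k)
findCell x [] = nothing
findCell x (y ∷ ys) with ≡-dec _≟_ _≟_ x y
... | yes _ = just fzero
... | no _ = Maybe.map fsuc (findCell x ys)

-- jeu de taquin slide of the hole h into the (straight-shape) tableau v
-- (v lists the cells of its entries in increasing order); returns the new
-- tableau and the finally vacated cell.  Fuel: each entry moves at most once.
slide : ∀ {k} → ℕ → Cell → Vec Cell k → Vec Cell k × Cell
slide zero h v = v , h
slide {k} (suc f) (r , c) v = go (findCell (r , suc c) v) (findCell (suc r , c) v)
  where
  mv : Fin k → Vec Cell k × Cell
  mv a = slide f (Vec.lookup v a) (v [ a ]≔ (r , c))
  go : Maybe (Fin k) → Maybe (Fin k) → Vec Cell k × Cell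
  go nothing nothing = v , (r , c)
  go (just a) nothing = mv a
  go nothing (just b) = mv b
  go (just a) (just b) = if toℕ a <ᵇ toℕ b then mv a else mv b

-- evacuation: delete the smallest entry, slide, and give the vacated cell
-- the largest remaining label; iterate.
evac : ∀ k → Vec Cell k → Vec Cell k
evac zero [] = []
evac (suc k) (h ∷ rest) = evac k (proj₁ s) ∷ʳ proj₂ s
  where s = slide k h rest

evacL : List Cell → List Cell
evacL xs = Vec.toList (evac (length xs) (Vec.fromList xs))

schutz : ℕ → List Cell → List Cell
schutz j T = evacL (take j T) ++ drop j T

-- Cactus group action:  s_[1,j] = schutz j, and (by the cactus relations)
-- s_[i,j] = s_[1,j] s_[1,j-i+1] s_[1,j].

cactusAct : ℕ → ℕ → List Cell → List Cell
cactusAct i j T = schutz j (schutz (j ∸ i + 1) (schutz j T))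

DiagStep : ℕ → List Cell × List Cell → List Cell × List Cell → Set
DiagStep n (T₁ , T₂) (U₁ , U₂) =
  Σ ℕ λ i → Σ ℕ λ j → 1 ≤ i × i < j × j ≤ n
    × U₁ ≡ cactusAct i j T₁ × U₂ ≡ cactusAct i j T₂

-- same orbit of the diagonal C_n-action (generators are involutions, so the
-- reflexive-transitive closure is already symmetric)
SameOrbit : ℕ → List Cell × List Cell → List Cell × List Cell → Set
SameOrbit n = Star (DiagStep n)

pairTab : ∀ l₁ l₂ n → SYT l₁ n × SYT l₂ n → List Cell × List Cell
pairTab _ _ _ ((T₁ , _) , (T₂ , _)) = T₁ , T₂

-- A standard Young tableau of hook shape (α + 1, 1^β) is determined by its word, whose k-th letter says
-- whether the entry k + 2 lies in the arm or in the leg. On a hook, jeu de taquin only slides the hole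
-- along the arm or along the leg, so evacuation reverses the word and the cactus generator s_[i,j]
-- reverses the letters of the entries i + 1, …, j. A pair of hook tableaux is thus a word over the
-- letters {arm, leg}²; segment reversals permute the letters and include all adjacent transpositions, so
-- two pairs lie in the same orbit iff their words have the same numbers a, b, c, d of letters
-- (arm , arm), (arm , leg), (leg , arm), (leg , leg). The shapes fix a + b = α₁, c + d = β₁, a + c = α₂
-- and b + d = β₂, hence d − a, so the orbit is determined by min d a, which takes exactly the values
-- 0, …, min(α₁, β₁, α₂, β₂).
module Submission where

open import Defs
open import Data.Bool using (true; false; if_then_else_)
open import Data.Empty using (⊥-elim)
open import Data.Fin as Fin using (Fin; toℕ) renaming (zero to fzero; suc to fsuc)
import Data.Fin.Properties as Fin
open import Data.List as List using (List; []; _∷_; length; take; drop; _++_; reverse; [_]; filter)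
import Data.List.Properties as List
open import Data.List.Membership.Propositional using (_∈_)
open import Data.List.Membership.Propositional.Properties using (∈-∃++; ∈-lookup)
open import Data.List.Relation.Binary.Permutation.Propositional as Perm using (_↭_; ↭-refl; ↭-sym; ↭-trans; ↭-reflexive; prep)
import Data.List.Relation.Binary.Permutation.Propositional.Properties as Perm
open import Data.List.Relation.Unary.All as All using (All; []; _∷_)
open import Data.List.Relation.Unary.AllPairs using ([]; _∷_)
open import Data.List.Relation.Unary.Any as Any using (here; there)
import Data.List.Relation.Unary.Any.Properties as Any
open import Data.List.Relation.Unary.Linked as Linked using (Linked; _∷_)
open import Data.List.Relation.Unary.Unique.Propositional using (Unique)
open import Data.Maybe as Maybe using (just; nothing)
open import Data.Nat
open import Data.Nat.ListAction using (sum)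
open import Data.Nat.Properties
open import Data.Nat.Solver using (module +-*-Solver)
open import Data.Product as Product using (Σ; ∃; _×_; _,_; proj₁; proj₂; swap)
open import Data.Product.Properties using (≡-dec)
open import Data.Sum using (_⊎_; inj₁; inj₂)
open import Data.Vec as Vec using (Vec; []; _∷_; _[_]≔_)
import Data.Vec.Properties as Vec
open import Data.Vec.Relation.Binary.Pointwise.Extensional using (ext; Pointwise-≡⇒≡)
import Data.Vec.Relation.Unary.All as VecAll
import Data.Vec.Relation.Unary.All.Properties as VecAll
import Data.Vec.Relation.Unary.AllPairs as VecAllPairs
import Data.Vec.Relation.Unary.Any as VecAny
import Data.Vec.Relation.Unary.Any.Properties as VecAny
import Data.Vec.Relation.Unary.Unique.Propositional as VecUnique
import Data.Vec.Relation.Unary.Unique.Propositional.Properties as VecUnique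
open import Function using (_∘_)
open import Function.Bundles using (_⇔_; mk⇔; Equivalence)
open import Relation.Binary.Construct.Closure.ReflexiveTransitive using (Star; ε; _◅_; _◅◅_; gmap)
open import Relation.Binary.Definitions using (DecidableEquality; tri<; tri≈; tri>)
open import Relation.Binary.PropositionalEquality
  using (_≡_; _≢_; refl; sym; trans; cong; cong₂; subst; subst₂; module ≡-Reasoning)
open import Relation.Nullary using (yes; no; ¬_; does)
open import Relation.Nullary.Reflects using (ofʸ; ofⁿ)

-- Two-by-two tables with given margins

⊓-diagonal-injective : ∀ {a d a′ d′} → d + a′ ≡ d′ + a → d ⊓ a ≡ d′ ⊓ a′ → d ≡ d′
⊓-diagonal-injective {a} {d} {a′} {d′} shift same-min with <-cmp d d′
... | tri≈ _ d≡d′ _ = d≡d′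
... | tri< d<d′ _ _ =
  ⊥-elim (<-irrefl same-min (⊓-mono-< d<d′ (≰⇒> λ a′≤a → <-irrefl shift (+-mono-<-≤ d<d′ a′≤a))))
... | tri> _ _ d′<d =
  ⊥-elim (<-irrefl (sym same-min) (⊓-mono-< d′<d (≰⇒> λ a≤a′ → <-irrefl (sym shift) (+-mono-<-≤ d′<d a≤a′))))

table-determined : ∀ {a b c d a′ b′ c′ d′} →
  a + b ≡ a′ + b′ → a + c ≡ a′ + c′ → b + d ≡ b′ + d′ → d ⊓ a ≡ d′ ⊓ a′ → a ≡ a′ × b ≡ b′ × c ≡ c′ × d ≡ d′
table-determined {a} {b} {c} {d} {a′} {b′} {c′} {d′} row col₁ col₂ same-min = a≡a′ , b≡b′ , c≡c′ , d≡d′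
  where
  open +-*-Solver
  shift : d + a′ ≡ d′ + a
  shift = +-cancelʳ-≡ (b + b′) (d + a′) (d′ + a)
    (trans (solve 6 (λ a b d a′ b′ d′ → (d :+ a′) :+ (b :+ b′) := (b :+ d) :+ (a′ :+ b′)) refl a b d a′ b′ d′)
    (trans (cong₂ _+_ col₂ (sym row))
    (solve 6 (λ a b d a′ b′ d′ → (b′ :+ d′) :+ (a :+ b) := (d′ :+ a) :+ (b :+ b′)) refl a b d a′ b′ d′)))
  d≡d′ = ⊓-diagonal-injective shift same-min
  a≡a′ = +-cancelˡ-≡ d′ a a′ (trans (sym shift) (cong (_+ a′) d≡d′))
  b≡b′ = +-cancelˡ-≡ a b b′ (trans row (cong (_+ b′) (sym a≡a′)))
  c≡c′ = +-cancelˡ-≡ a c c′ (trans col₁ (cong (_+ c′) (sym a≡a′)))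

Table : ℕ → ℕ → ℕ → ℕ → ℕ → Set
Table α₁ β₁ α₂ β₂ k =
  ∃ λ a → ∃ λ b → ∃ λ c → ∃ λ d → a + b ≡ α₁ × c + d ≡ β₁ × a + c ≡ α₂ × b + d ≡ β₂ × d ⊓ a ≡ k

table-exists-≤ : ∀ {α₁ β₁ α₂ β₂ k} → α₁ + β₁ ≡ α₂ + β₂ → β₂ ≤ α₁ → k ≤ β₁ → k ≤ β₂ → Table α₁ β₁ α₂ β₂ k
table-exists-≤ {α₂ = α₂} {k = k} size β₂≤α₁ k≤β₁ k≤β₂
  with m≤n⇒∃[o]m+o≡n k≤β₂ | m≤n⇒∃[o]m+o≡n k≤β₁ | m≤n⇒∃[o]m+o≡n β₂≤α₁
... | x , refl | y , refl | e , refl =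
  k + e , x , y , k , solve 3 (λ k e x → (k :+ e) :+ x := (k :+ x) :+ e) refl k e x , +-comm y k ,
  sym α₂≡ , +-comm x k , m≤n⇒m⊓n≡m (m≤m+n k e)
  where
  open +-*-Solver
  α₂≡ : α₂ ≡ k + e + y
  α₂≡ = +-cancelʳ-≡ (k + x) α₂ (k + e + y)
    (trans (sym size) (solve 4 (λ k e x y → ((k :+ x) :+ e) :+ (k :+ y) := ((k :+ e) :+ y) :+ (k :+ x)) refl k e x y))

-- The case α₁ ≤ β₂ reduces to the other one by rotating the table: (a, b, c, d) ↦ (d, b, c, a).
table-exists : ∀ {α₁ β₁ α₂ β₂ k} → α₁ + β₁ ≡ α₂ + β₂ → k ≤ α₁ ⊓ β₁ ⊓ α₂ ⊓ β₂ → Table α₁ β₁ α₂ β₂ k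
table-exists {α₁} {β₁} {α₂} {β₂} size k≤ with ≤-total β₂ α₁
... | inj₁ β₂≤α₁ = table-exists-≤ size β₂≤α₁ k≤β₁ k≤β₂
  where
  k≤β₁ = m≤n⊓o⇒m≤o α₁ β₁ (m≤n⊓o⇒m≤n _ α₂ (m≤n⊓o⇒m≤n _ β₂ k≤))
  k≤β₂ = m≤n⊓o⇒m≤o _ β₂ k≤
... | inj₂ α₁≤β₂
  with table-exists-≤ {β₂} {α₂} {β₁} {α₁} (trans (+-comm β₂ α₂) (trans (sym size) (+-comm α₁ β₁))) α₁≤β₂ k≤α₂ k≤α₁
  where
  k≤α₁ = m≤n⊓o⇒m≤n α₁ β₁ (m≤n⊓o⇒m≤n _ α₂ (m≤n⊓o⇒m≤n _ β₂ k≤))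
  k≤α₂ = m≤n⊓o⇒m≤o _ α₂ (m≤n⊓o⇒m≤n _ β₂ k≤)
...   | a , b , c , d , ab , cd , ac , bd , min≡ =
  d , b , c , a , trans (+-comm d b) bd , trans (+-comm c a) ac , trans (+-comm d c) cd , trans (+-comm b a) ab ,
  trans (⊓-comm a d) min≡

lookup-injective : ∀ {A : Set} {xs : List A} → Unique xs → ∀ i j → List.lookup xs i ≡ List.lookup xs j → i ≡ j
lookup-injective (_ ∷ _) fzero fzero _ = refl
lookup-injective (x∉ ∷ _) fzero (fsuc j) e = ⊥-elim (All.lookup x∉ (∈-lookup j) e)
lookup-injective (x∉ ∷ _) (fsuc i) fzero e = ⊥-elim (All.lookup x∉ (∈-lookup i) (sym e))
lookup-injective (_ ∷ u) (fsuc i) (fsuc j) e = cong fsuc (lookup-injective u i j e)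

module _ {A : Set} where

  lookup-toList-All : ∀ {k} {P : A → Set} (V : Vec A k) {L} → Vec.toList V ≡ L → All P L → ∀ i → P (Vec.lookup V i)
  lookup-toList-All V refl ps = VecAll.lookup⁺ (VecAll.toList⁻ ps)

  lookup-toList-∈ : ∀ {k} (V : Vec A k) {L x} → Vec.toList V ≡ L → x ∈ L → ∃ λ i → Vec.lookup V i ≡ x
  lookup-toList-∈ V refl x∈ = let p = VecAny.toList⁻ x∈ in VecAny.index p , sym (VecAny.lookup-index p)

  unique-toList⁻ : ∀ {k} {V : Vec A k} → Unique (Vec.toList V) → VecUnique.Unique V
  unique-toList⁻ {V = []} [] = VecAllPairs.[]
  unique-toList⁻ {V = x ∷ V} (x∉ ∷ u) = VecAll.toList⁻ x∉ VecAllPairs.∷ unique-toList⁻ u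

  lookup-toList-injective : ∀ {k} (V : Vec A k) {L} → Vec.toList V ≡ L → Unique L →
    ∀ i j → Vec.lookup V i ≡ Vec.lookup V j → i ≡ j
  lookup-toList-injective V refl u = VecUnique.lookup-injective (unique-toList⁻ u)

take-length-++ : ∀ {A : Set} (u v : List A) → take (length u) (u ++ v) ≡ u
take-length-++ [] v = refl
take-length-++ (x ∷ u) v = cong (x ∷_) (take-length-++ u v)

drop-length-++ : ∀ {A : Set} (u v : List A) → drop (length u) (u ++ v) ≡ v
drop-length-++ [] v = refl
drop-length-++ (x ∷ u) v = drop-length-++ u v

zip-proj : ∀ {A B : Set} (xs : List A) (ys : List B) → length xs ≡ length ys →
  List.map proj₁ (List.zip xs ys) ≡ xs × List.map proj₂ (List.zip xs ys) ≡ ys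
zip-proj [] [] _ = refl , refl
zip-proj (x ∷ xs) (y ∷ ys) e = Product.map (cong (x ∷_)) (cong (y ∷_)) (zip-proj xs ys (suc-injective e))

map-proj-injective : ∀ {A B : Set} {P Q : List (A × B)} →
  List.map proj₁ P ≡ List.map proj₁ Q → List.map proj₂ P ≡ List.map proj₂ Q → P ≡ Q
map-proj-injective {P = []} {[]} _ _ = refl
map-proj-injective {P = _ ∷ _} {_ ∷ _} e₁ e₂ = cong₂ _∷_
  (cong₂ _,_ (List.∷-injectiveˡ e₁) (List.∷-injectiveˡ e₂))
  (map-proj-injective (List.∷-injectiveʳ e₁) (List.∷-injectiveʳ e₂))

module Multiplicity {A : Set} (_≟_ : DecidableEquality A) where

  count : A → List A → ℕ
  count x xs = length (filter (_≟ x) xs)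

  count-↭ : ∀ {xs ys} → xs ↭ ys → ∀ x → count x xs ≡ count x ys
  count-↭ xs↭ys x = Perm.↭-length (Perm.filter-↭ (_≟ x) xs↭ys)

  count-here : ∀ x xs → 0 < count x (x ∷ xs)
  count-here x xs with x ≟ x
  ... | yes _ = s≤s z≤n
  ... | no x≢x = ⊥-elim (x≢x refl)

  count>0⇒∈ : ∀ x xs → 0 < count x xs → x ∈ xs
  count>0⇒∈ x (y ∷ xs) pos with y ≟ x
  ... | yes refl = here refl
  ... | no _ = there (count>0⇒∈ x xs pos)

  count-∷-cancel : ∀ y {xs ys} x → count x (y ∷ xs) ≡ count x (y ∷ ys) → count x xs ≡ count x ys
  count-∷-cancel y x e with y ≟ x
  ... | yes _ = suc-injective e
  ... | no _ = e

  count-++ : ∀ x xs ys → count x (xs ++ ys) ≡ count x xs + count x ys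
  count-++ x xs ys = trans (cong length (List.filter-++ (_≟ x) xs ys)) (List.length-++ (filter (_≟ x) xs))

  count-replicate : ∀ k x y → count x (List.replicate k y) ≡ (if does (y ≟ x) then k else 0)
  count-replicate zero x y with does (y ≟ x)
  ... | true = refl
  ... | false = refl
  count-replicate (suc k) x y with y ≟ x | count-replicate k x y
  ... | yes _ | ih = cong suc ih
  ... | no _ | ih = ih

  count-blocks : ∀ (t : A → ℕ) x ys →
    count x (List.concatMap (λ y → List.replicate (t y) y) ys) ≡ sum (List.map (λ y → if does (y ≟ x) then t y else 0) ys)
  count-blocks t x [] = refl
  count-blocks t x (y ∷ ys) =
    trans (count-++ x (List.replicate (t y) y) _) (cong₂ _+_ (count-replicate (t y) x y) (count-blocks t x ys))

  count≡⇒↭ : ∀ xs ys → (∀ x → count x xs ≡ count x ys) → xs ↭ ys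
  count≡⇒↭ [] [] _ = ↭-refl
  count≡⇒↭ [] (y ∷ ys) same with () ← subst (0 <_) (sym (same y)) (count-here y ys)
  count≡⇒↭ (x ∷ xs) ys same with ∈-∃++ (count>0⇒∈ x ys (subst (0 <_) (same x) (count-here x xs)))
  ... | us , vs , refl = ↭-trans (prep x (count≡⇒↭ xs (us ++ vs) same′)) (↭-sym (Perm.shift x us vs))
    where
    same′ : ∀ z → count z xs ≡ count z (us ++ vs)
    same′ z = count-∷-cancel x z (trans (same z) (count-↭ (Perm.shift x us vs) z))

reversePrefix : ∀ {A : Set} → ℕ → List A → List A
reversePrefix m w = reverse (take m w) ++ drop m w

reversePrefix-++ : ∀ {A : Set} (u v : List A) → reversePrefix (length u) (u ++ v) ≡ reverse u ++ v
reversePrefix-++ u v = cong₂ (λ t d → reverse t ++ d) (take-length-++ u v) (drop-length-++ u v)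

reversePrefix-++-++ : ∀ {A : Set} (x y v : List A) → reversePrefix (length x + length y) (x ++ y ++ v) ≡ reverse y ++ reverse x ++ v
reversePrefix-++-++ x y v = begin
  reversePrefix (length x + length y) (x ++ y ++ v) ≡⟨ cong₂ reversePrefix (List.length-++ x) (List.++-assoc x y v) ⟨
  reversePrefix (length (x ++ y)) ((x ++ y) ++ v)   ≡⟨ reversePrefix-++ (x ++ y) v ⟩
  reverse (x ++ y) ++ v                             ≡⟨ cong (_++ v) (List.reverse-++ x y) ⟩
  (reverse y ++ reverse x) ++ v                     ≡⟨ List.++-assoc (reverse y) (reverse x) v ⟩
  reverse y ++ reverse x ++ v                       ∎
  where open ≡-Reasoning

reversePrefix-↭ : ∀ {A : Set} m (w : List A) → reversePrefix m w ↭ w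
reversePrefix-↭ m w = ↭-trans (Perm.++⁺ʳ (drop m w) (Perm.↭-reverse (take m w))) (↭-reflexive (List.take++drop≡id m w))

map-reversePrefix : ∀ {A B : Set} (f : A → B) m w → List.map f (reversePrefix m w) ≡ reversePrefix m (List.map f w)
map-reversePrefix f m w = trans (List.map-++ f (reverse (take m w)) (drop m w))
  (cong₂ _++_ (trans (List.reverse-map f (take m w)) (cong reverse (sym (List.take-map m w)))) (sym (List.drop-map m w)))

-- s_[i,j] = s_[1,j] s_[1,j-i+1] s_[1,j] on words, where s_[1,j] reverses the first j ∸ 1 letters.
cactusWord : ∀ {A : Set} → ℕ → ℕ → List A → List A
cactusWord i j = reversePrefix (j ∸ 1) ∘ reversePrefix (j ∸ i) ∘ reversePrefix (j ∸ 1)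

cactusWord-↭ : ∀ {A : Set} i j (w : List A) → cactusWord i j w ↭ w
cactusWord-↭ i j w = ↭-trans (reversePrefix-↭ (j ∸ 1) _) (↭-trans (reversePrefix-↭ (j ∸ i) _) (reversePrefix-↭ (j ∸ 1) w))

map-cactusWord : ∀ {A B : Set} (f : A → B) i j w → List.map f (cactusWord i j w) ≡ cactusWord i j (List.map f w)
map-cactusWord f i j w = trans (map-reversePrefix f (j ∸ 1) _) (cong (reversePrefix (j ∸ 1))
  (trans (map-reversePrefix f (j ∸ i) _) (cong (reversePrefix (j ∸ i)) (map-reversePrefix f (j ∸ 1) w))))

cactusWord-reverses : ∀ {A : Set} (u s v : List A) →
  cactusWord (suc (length u)) (suc (length u + length s)) (u ++ s ++ v) ≡ u ++ reverse s ++ v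
cactusWord-reverses u s v = begin
  reversePrefix m (reversePrefix (suc m ∸ suc (length u)) (reversePrefix m (u ++ s ++ v)))
    ≡⟨ cong (λ t → reversePrefix m (reversePrefix t (reversePrefix m (u ++ s ++ v)))) (m+n∸m≡n (length u) (length s)) ⟩
  reversePrefix m (reversePrefix (length s) (reversePrefix m (u ++ s ++ v)))
    ≡⟨ cong (λ t → reversePrefix m (reversePrefix (length s) t)) (reversePrefix-++-++ u s v) ⟩
  reversePrefix m (reversePrefix (length s) (reverse s ++ reverse u ++ v))
    ≡⟨ cong (λ t → reversePrefix m (reversePrefix t (reverse s ++ reverse u ++ v))) (List.length-reverse s) ⟨
  reversePrefix m (reversePrefix (length (reverse s)) (reverse s ++ reverse u ++ v))
    ≡⟨ cong (reversePrefix m) (reversePrefix-++ (reverse s) (reverse u ++ v)) ⟩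
  reversePrefix m (reverse (reverse s) ++ reverse u ++ v)
    ≡⟨ cong (λ t → reversePrefix m (t ++ reverse u ++ v)) (List.reverse-involutive s) ⟩
  reversePrefix m (s ++ reverse u ++ v)
    ≡⟨ cong (λ t → reversePrefix t (s ++ reverse u ++ v))
         (trans (+-comm (length u) (length s)) (cong (length s +_) (sym (List.length-reverse u)))) ⟩
  reversePrefix (length s + length (reverse u)) (s ++ reverse u ++ v)
    ≡⟨ reversePrefix-++-++ s (reverse u) v ⟩
  reverse (reverse u) ++ reverse s ++ v
    ≡⟨ cong (_++ reverse s ++ v) (List.reverse-involutive u) ⟩
  u ++ reverse s ++ v ∎
  where
  open ≡-Reasoning
  m = length u + length s

data AdjacentSwap {A : Set} : List A → List A → Set where
  swap-at : ∀ u x y v → AdjacentSwap (u ++ x ∷ y ∷ v) (u ++ y ∷ x ∷ v)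

AdjacentSwap-length : ∀ {A : Set} {xs ys : List A} → AdjacentSwap xs ys → length xs ≡ length ys
AdjacentSwap-length (swap-at u x y v) = trans (List.length-++ u) (sym (List.length-++ u))

adjacent-swaps-∷ : ∀ {A : Set} (z : A) {xs ys} → Star AdjacentSwap xs ys → Star AdjacentSwap (z ∷ xs) (z ∷ ys)
adjacent-swaps-∷ z = gmap (z ∷_) λ { (swap-at u x y v) → swap-at (z ∷ u) x y v }

↭⇒adjacent-swaps : ∀ {A : Set} {xs ys : List A} → xs ↭ ys → Star AdjacentSwap xs ys
↭⇒adjacent-swaps Perm.refl = ε
↭⇒adjacent-swaps (Perm.prep x p) = adjacent-swaps-∷ x (↭⇒adjacent-swaps p)
↭⇒adjacent-swaps (Perm.swap x y p) = swap-at [] x y _ ◅ adjacent-swaps-∷ y (adjacent-swaps-∷ x (↭⇒adjacent-swaps p))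
↭⇒adjacent-swaps (Perm.trans p q) = ↭⇒adjacent-swaps p ◅◅ ↭⇒adjacent-swaps q

-- Hook words

data Letter : Set where
  arm leg : Letter

flip : Letter → Letter
flip arm = leg
flip leg = arm

flip-involutive : ∀ x → flip (flip x) ≡ x
flip-involutive arm = refl
flip-involutive leg = refl

_≟ᴸ_ : DecidableEquality Letter
arm ≟ᴸ arm = yes refl
arm ≟ᴸ leg = no λ ()
leg ≟ᴸ arm = no λ ()
leg ≟ᴸ leg = yes refl

Word : Set
Word = List Letter

arms legs : Word → ℕ
arms [] = 0
arms (arm ∷ w) = suc (arms w)
arms (leg ∷ w) = arms w
legs w = arms (List.map flip w)

arms-++ : ∀ u v → arms (u ++ v) ≡ arms u + arms v
arms-++ [] v = refl
arms-++ (arm ∷ u) v = cong suc (arms-++ u v)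
arms-++ (leg ∷ u) v = arms-++ u v

arms-reverse : ∀ u → arms (reverse u) ≡ arms u
arms-reverse [] = refl
arms-reverse (x ∷ u) = begin
  arms (reverse (x ∷ u))       ≡⟨ cong arms (List.unfold-reverse x u) ⟩
  arms (reverse u ++ [ x ])    ≡⟨ arms-++ (reverse u) [ x ] ⟩
  arms (reverse u) + arms [ x ] ≡⟨ cong (_+ arms [ x ]) (arms-reverse u) ⟩
  arms u + arms [ x ]          ≡⟨ +-comm (arms u) (arms [ x ]) ⟩
  arms [ x ] + arms u          ≡⟨ arms-++ [ x ] u ⟨
  arms (x ∷ u)                 ∎
  where open ≡-Reasoning

legs-reverse : ∀ u → legs (reverse u) ≡ legs u
legs-reverse u = trans (cong arms (List.reverse-map flip u)) (arms-reverse (List.map flip u))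

arms+legs : ∀ w → arms w + legs w ≡ length w
arms+legs [] = refl
arms+legs (arm ∷ w) = cong suc (arms+legs w)
arms+legs (leg ∷ w) = trans (+-suc (arms w) (legs w)) (cong suc (arms+legs w))

map-flip-involutive : ∀ w → List.map flip (List.map flip w) ≡ w
map-flip-involutive w = trans (sym (List.map-∘ w)) (trans (List.map-cong flip-involutive w) (List.map-id w))

-- The entry k + 2 of hookTableau w occupies the next free cell of the arm or of the leg, according to the
-- k-th letter of w; the next free cells are (0 , p) and (q , 0).
hookCells : ℕ → ℕ → Word → List Cell
hookCells p q [] = []
hookCells p q (arm ∷ w) = (0 , p) ∷ hookCells (suc p) q w
hookCells p q (leg ∷ w) = (q , 0) ∷ hookCells p (suc q) w

hookTableau : Word → List Cell
hookTableau w = (0 , 0) ∷ hookCells 1 1 w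

newCell : Letter → Word → Cell
newCell arm u = (0 , suc (arms u))
newCell leg u = (suc (legs u) , 0)

hookCells-++ : ∀ p q u v → hookCells p q (u ++ v) ≡ hookCells p q u ++ hookCells (p + arms u) (q + legs u) v
hookCells-++ p q [] v = cong₂ (λ p' q' → hookCells p' q' v) (sym (+-identityʳ p)) (sym (+-identityʳ q))
hookCells-++ p q (arm ∷ u) v = cong ((0 , p) ∷_)
  (trans (hookCells-++ (suc p) q u v) (cong (λ p' → hookCells (suc p) q u ++ hookCells p' (q + legs u) v) (sym (+-suc p (arms u)))))
hookCells-++ p q (leg ∷ u) v = cong ((q , 0) ∷_)
  (trans (hookCells-++ p (suc q) u v) (cong (λ q' → hookCells p (suc q) u ++ hookCells (p + arms u) q' v) (sym (+-suc q (legs u)))))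

hookTableau-snoc : ∀ u x → hookTableau (u ++ [ x ]) ≡ hookTableau u ++ [ newCell x u ]
hookTableau-snoc u arm = cong ((0 , 0) ∷_) (hookCells-++ 1 1 u [ arm ])
hookTableau-snoc u leg = cong ((0 , 0) ∷_) (hookCells-++ 1 1 u [ leg ])

newCell-reverse : ∀ x u → newCell x (reverse u) ≡ newCell x u
newCell-reverse arm u = cong (λ a → 0 , suc a) (arms-reverse u)
newCell-reverse leg u = cong (λ l → suc l , 0) (legs-reverse u)

length-hookCells : ∀ p q w → length (hookCells p q w) ≡ length w
length-hookCells p q [] = refl
length-hookCells p q (arm ∷ w) = cong suc (length-hookCells _ _ w)
length-hookCells p q (leg ∷ w) = cong suc (length-hookCells _ _ w)

hookCells-take : ∀ k p q w → take k (hookCells p q w) ≡ hookCells p q (take k w)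
hookCells-take zero p q w = refl
hookCells-take (suc k) p q [] = refl
hookCells-take (suc k) p q (arm ∷ w) = cong ((0 , p) ∷_) (hookCells-take k (suc p) q w)
hookCells-take (suc k) p q (leg ∷ w) = cong ((q , 0) ∷_) (hookCells-take k p (suc q) w)

hookCells-drop : ∀ k p q w → drop k (hookCells p q w) ≡ hookCells (p + arms (take k w)) (q + legs (take k w)) (drop k w)
hookCells-drop zero p q w = cong₂ (λ p' q' → hookCells p' q' w) (sym (+-identityʳ p)) (sym (+-identityʳ q))
hookCells-drop (suc k) p q [] = refl
hookCells-drop (suc k) p q (arm ∷ w) = trans (hookCells-drop k (suc p) q w)
  (cong (λ p' → hookCells p' (q + legs (take k w)) (drop k w)) (sym (+-suc p (arms (take k w)))))
hookCells-drop (suc k) p q (leg ∷ w) = trans (hookCells-drop k p (suc q) w)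
  (cong (λ q' → hookCells (p + arms (take k w)) q' (drop k w)) (sym (+-suc q (legs (take k w)))))

hookCells-transpose : ∀ p q w → List.map swap (hookCells p q w) ≡ hookCells q p (List.map flip w)
hookCells-transpose p q [] = refl
hookCells-transpose p q (arm ∷ w) = cong ((p , 0) ∷_) (hookCells-transpose (suc p) q w)
hookCells-transpose p q (leg ∷ w) = cong ((0 , q) ∷_) (hookCells-transpose p (suc q) w)

hookTableau-transpose : ∀ w → List.map swap (hookTableau w) ≡ hookTableau (List.map flip w)
hookTableau-transpose w = cong ((0 , 0) ∷_) (hookCells-transpose 1 1 w)

hookCells-All : ∀ (P : Cell → Set) p q w →
  (∀ c → p ≤ c → c < p + arms w → P (0 , c)) → (∀ r → q ≤ r → r < q + legs w → P (r , 0)) →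
  All P (hookCells p q w)
hookCells-All P p q [] _ _ = []
hookCells-All P p q (arm ∷ w) armP legP =
  armP p ≤-refl (≤-trans (m≤m+n (suc p) (arms w)) (≤-reflexive (sym (+-suc p (arms w)))))
  ∷ hookCells-All P (suc p) q w (λ c p<c c< → armP c (<⇒≤ p<c) (≤-trans c< (≤-reflexive (sym (+-suc p (arms w)))))) legP
hookCells-All P p q (leg ∷ w) armP legP =
  legP q ≤-refl (≤-trans (m≤m+n (suc q) (legs w)) (≤-reflexive (sym (+-suc q (legs w)))))
  ∷ hookCells-All P p (suc q) w armP (λ r q<r r< → legP r (<⇒≤ q<r) (≤-trans r< (≤-reflexive (sym (+-suc q (legs w))))))

∈-hookCells-arm : ∀ p q w c → p ≤ c → c < p + arms w → (0 , c) ∈ hookCells p q w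
∈-hookCells-arm p q [] c p≤c c<p+0 = ⊥-elim (<-irrefl refl (≤-trans c<p+0 (≤-trans (≤-reflexive (+-identityʳ p)) p≤c)))
∈-hookCells-arm p q (leg ∷ w) c p≤c c< = there (∈-hookCells-arm p (suc q) w c p≤c c<)
∈-hookCells-arm p q (arm ∷ w) c p≤c c< with m≤n⇒m<n∨m≡n p≤c
... | inj₂ refl = here refl
... | inj₁ p<c = there (∈-hookCells-arm (suc p) q w c p<c (≤-trans c< (≤-reflexive (+-suc p (arms w)))))

∈-hookCells-leg : ∀ p q w r → q ≤ r → r < q + legs w → (r , 0) ∈ hookCells p q w
∈-hookCells-leg p q [] r q≤r r<q+0 = ⊥-elim (<-irrefl refl (≤-trans r<q+0 (≤-trans (≤-reflexive (+-identityʳ q)) q≤r)))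
∈-hookCells-leg p q (arm ∷ w) r q≤r r< = there (∈-hookCells-leg (suc p) q w r q≤r r<)
∈-hookCells-leg p q (leg ∷ w) r q≤r r< with m≤n⇒m<n∨m≡n q≤r
... | inj₂ refl = here refl
... | inj₁ q<r = there (∈-hookCells-leg p (suc q) w r q<r (≤-trans r< (≤-reflexive (+-suc q (legs w)))))

unique-hookCells : ∀ p q w → 1 ≤ p → 1 ≤ q → Unique (hookCells p q w)
unique-hookCells p q [] _ _ = []
unique-hookCells p q (arm ∷ w) 1≤p 1≤q =
  hookCells-All _ (suc p) q w
    (λ c p<c _ e → <-irrefl (cong proj₂ e) p<c) (λ r q≤r _ e → <-irrefl (cong proj₁ e) (≤-trans 1≤q q≤r))
  ∷ unique-hookCells (suc p) q w (m≤n⇒m≤1+n 1≤p) 1≤q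
unique-hookCells p q (leg ∷ w) 1≤p 1≤q =
  hookCells-All _ p (suc q) w
    (λ c p≤c _ e → <-irrefl (cong proj₂ e) (≤-trans 1≤p p≤c)) (λ r q<r _ e → <-irrefl (cong proj₁ e) q<r)
  ∷ unique-hookCells p (suc q) w 1≤p (m≤n⇒m≤1+n 1≤q)

unique-hookTableau : ∀ w → Unique (hookTableau w)
unique-hookTableau w =
  hookCells-All _ 1 1 w (λ c 1≤c _ e → <-irrefl (cong proj₂ e) 1≤c) (λ r 1≤r _ e → <-irrefl (cong proj₁ e) 1≤r)
  ∷ unique-hookCells 1 1 w ≤-refl ≤-refl

hookCells-no-inner : ∀ p q w → All (λ y → ∀ r c → y ≢ (suc r , suc c)) (hookCells p q w)
hookCells-no-inner p q w = hookCells-All _ p q w (λ { _ _ _ _ _ () }) (λ { _ _ _ _ _ () })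

hookCells-arm-bounded : ∀ w → All (λ y → ∀ c → y ≡ (0 , suc c) → c < arms w) (hookCells 1 1 w)
hookCells-arm-bounded w = hookCells-All _ 1 1 w (λ { _ _ c<1+a c refl → ≤-pred c<1+a }) (λ { _ _ _ c () })

letterOf : Cell → Letter
letterOf (zero , _) = arm
letterOf (suc _ , _) = leg

letterOf-hookCells : ∀ p q w → List.map letterOf (hookCells p (suc q) w) ≡ w
letterOf-hookCells p q [] = refl
letterOf-hookCells p q (arm ∷ w) = cong (arm ∷_) (letterOf-hookCells (suc p) q w)
letterOf-hookCells p q (leg ∷ w) = cong (leg ∷_) (letterOf-hookCells p (suc q) w)

hookTableau-injective : ∀ {u v} → hookTableau u ≡ hookTableau v → u ≡ v
hookTableau-injective {u} {v} e =
  trans (sym (letterOf-hookCells 1 0 u)) (trans (cong (List.map letterOf) (List.∷-injectiveʳ e)) (letterOf-hookCells 1 0 v))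

-- Standard Young tableaux of hook shape

hookShape : ℕ → ℕ → List ℕ
hookShape α β = suc α ∷ List.replicate β 1

c₁-hookShape : ∀ α β → c₁ (hookShape α β) ≡ suc β
c₁-hookShape α β = cong suc (List.length-replicate β)

all-ones : ∀ xs → Linked (λ a b → b ≤ a) xs → All (1 ≤_) xs → rowLen xs 0 ≤ 1 → xs ≡ List.replicate (length xs) 1
all-ones [] _ _ _ = refl
all-ones (y ∷ []) _ (1≤y ∷ []) y≤1 = cong (_∷ []) (≤-antisym y≤1 1≤y)
all-ones (y ∷ z ∷ zs) (z≤y ∷ linked) (1≤y ∷ positive) y≤1 =
  cong₂ _∷_ (≤-antisym y≤1 1≤y) (all-ones (z ∷ zs) linked positive (≤-trans z≤y y≤1))

hook-partition : ∀ n lam → 1 ≤ n → IsPartition n lam → IsHook lam →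
  ∃ λ α → ∃ λ β → lam ≡ hookShape α β × suc (α + β) ≡ n
hook-partition n [] 1≤n (_ , _ , refl) _ = ⊥-elim (<-irrefl refl 1≤n)
hook-partition n (suc α ∷ xs) _ (linked , (_ ∷ positive) , sum≡n) hook =
  α , length xs , cong (suc α ∷_) xs≡ , trans (cong (suc α +_) (sym (trans (cong sum xs≡) (sum-replicate (length xs))))) sum≡n
  where
  xs≡ : xs ≡ List.replicate (length xs) 1
  xs≡ = all-ones xs (Linked.tail linked) positive (≮⇒≥ hook)
  sum-replicate : ∀ k → sum (List.replicate k 1) ≡ k
  sum-replicate zero = refl
  sum-replicate (suc k) = cong suc (sum-replicate k)

rowLen-replicate : ∀ β r → r < β → rowLen (List.replicate β 1) r ≡ 1
rowLen-replicate (suc β) zero _ = refl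
rowLen-replicate (suc β) (suc r) (s≤s r<β) = rowLen-replicate β r r<β

InDiagram-replicate⁻ : ∀ β r c → c < rowLen (List.replicate β 1) r → c ≡ 0 × r < β
InDiagram-replicate⁻ (suc β) zero zero _ = refl , s≤s z≤n
InDiagram-replicate⁻ (suc β) zero (suc c) (s≤s ())
InDiagram-replicate⁻ (suc β) (suc r) c lt = Product.map₂ s≤s (InDiagram-replicate⁻ β r c lt)

InDiagram-hook⁻ : ∀ α β x → InDiagram (hookShape α β) x →
  (∃ λ c → x ≡ (0 , c) × c ≤ α) ⊎ (∃ λ r → x ≡ (suc r , 0) × r < β)
InDiagram-hook⁻ α β (zero , c) c≤α = inj₁ (c , refl , ≤-pred c≤α)
InDiagram-hook⁻ α β (suc r , c) lt with InDiagram-replicate⁻ β r c lt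
... | refl , r<β = inj₂ (r , refl , r<β)

InDiagram-hook-leg : ∀ α β r → r < β → InDiagram (hookShape α β) (suc r , 0)
InDiagram-hook-leg α β r r<β = ≤-trans (s≤s z≤n) (≤-reflexive (sym (rowLen-replicate β r r<β)))

hookTableau-InDiagram : ∀ w → All (InDiagram (hookShape (arms w) (legs w))) (hookTableau w)
hookTableau-InDiagram w = s≤s z≤n
  ∷ hookCells-All _ 1 1 w (λ _ _ c<1+a → c<1+a) (λ { (suc r) _ (s≤s r<l) → InDiagram-hook-leg (arms w) (legs w) r r<l })

hookTableau-covers : ∀ w x → InDiagram (hookShape (arms w) (legs w)) x → x ∈ hookTableau w
hookTableau-covers w (zero , zero) _ = here refl
hookTableau-covers w (zero , suc c) c<a = there (∈-hookCells-arm 1 1 w (suc c) (s≤s z≤n) c<a)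
hookTableau-covers w (suc r , c) lt with InDiagram-replicate⁻ (legs w) r c lt
... | refl , r<l = there (∈-hookCells-leg 1 1 w (suc r) (s≤s z≤n) (s≤s r<l))

MayFollow : Cell → Cell → Set
MayFollow y z = (row z ≡ row y → ¬ col z < col y) × (col z ≡ col y → ¬ row z < row y)

standard-∷ : ∀ y ys → All (MayFollow y) ys → IsStandardFilling ys → IsStandardFilling (y ∷ ys)
standard-∷ y ys _ _ fzero fzero = (λ _ lt → ⊥-elim (<-irrefl refl lt)) , (λ _ lt → ⊥-elim (<-irrefl refl lt))
standard-∷ y ys _ _ fzero (fsuc j) = (λ _ _ → s≤s z≤n) , (λ _ _ → s≤s z≤n)
standard-∷ y ys follow _ (fsuc i) fzero =
  (λ e lt → ⊥-elim (proj₁ (All.lookup follow (∈-lookup i)) e lt)) ,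
  (λ e lt → ⊥-elim (proj₂ (All.lookup follow (∈-lookup i)) e lt))
standard-∷ y ys _ std (fsuc i) (fsuc j) = Product.map (λ f e lt → s≤s (f e lt)) (λ f e lt → s≤s (f e lt)) (std i j)

standard-hookCells : ∀ p q w → 1 ≤ p → 1 ≤ q → IsStandardFilling (hookCells p q w)
standard-hookCells p q [] _ _ ()
standard-hookCells p q (arm ∷ w) 1≤p 1≤q = standard-∷ (0 , p) _
  (hookCells-All _ (suc p) q w
    (λ c p<c _ → (λ _ c<p → <-asym c<p p<c) , (λ e _ → <-irrefl (sym e) p<c))
    (λ r q≤r _ → (λ e _ → <-irrefl (sym e) (≤-trans 1≤q q≤r)) , (λ e _ → <-irrefl e 1≤p)))
  (standard-hookCells (suc p) q w (m≤n⇒m≤1+n 1≤p) 1≤q)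
standard-hookCells p q (leg ∷ w) 1≤p 1≤q = standard-∷ (q , 0) _
  (hookCells-All _ p (suc q) w
    (λ c p≤c _ → (λ e _ → <-irrefl e 1≤q) , (λ e _ → <-irrefl (sym e) (≤-trans 1≤p p≤c)))
    (λ r q<r _ → (λ e _ → <-irrefl (sym e) q<r) , (λ _ r<q → <-asym r<q q<r)))
  (standard-hookCells p (suc q) w 1≤p (m≤n⇒m≤1+n 1≤q))

standard-hookTableau : ∀ w → IsStandardFilling (hookTableau w)
standard-hookTableau w = standard-∷ (0 , 0) _
  (hookCells-All _ 1 1 w
    (λ c 1≤c _ → (λ _ ()) , (λ e _ → <-irrefl (sym e) 1≤c)) (λ r 1≤r _ → (λ e _ → <-irrefl (sym e) 1≤r) , (λ _ ())))
  (standard-hookCells 1 1 w ≤-refl ≤-refl)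

hookTableau-SYT : ∀ w → IsSYT (hookShape (arms w) (legs w)) (suc (arms w + legs w)) (hookTableau w)
hookTableau-SYT w =
  cong suc (trans (length-hookCells 1 1 w) (sym (arms+legs w))) ,
  (λ a → All.lookup (hookTableau-InDiagram w) (∈-lookup a)) ,
  lookup-injective (unique-hookTableau w) ,
  (λ x x∈λ → let x∈ = hookTableau-covers w x x∈λ in Any.index x∈ , sym (Any.lookup-index x∈)) ,
  standard-hookTableau w

Precedes : List Cell → ℕ → Cell → Set
Precedes xs i x = ∃ λ j → toℕ j < i × List.lookup xs j ≡ x

Precedes-tail : ∀ {y ys i x} → y ≢ x → Precedes (y ∷ ys) (suc i) x → Precedes ys i x
Precedes-tail y≢x (fzero , _ , e) = ⊥-elim (y≢x e)
Precedes-tail _ (fsuc j , s≤s j<i , e) = j , j<i , e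

standard-earlier : ∀ lam {n T} → IsSYT lam n T → ∀ i {x y} → List.lookup T i ≡ y → InDiagram lam x →
  (row x ≡ row y × col x < col y) ⊎ (col x ≡ col y × row x < row y) → Precedes T (toℕ i) x
standard-earlier _ (_ , _ , _ , cover , std) i {x} refl x∈λ before with cover x x∈λ
... | a , refl with before
...   | inj₁ (same-row , left) = a , proj₁ (std a i) same-row left , refl
...   | inj₂ (same-col , above) = a , proj₂ (std a i) same-col above , refl

-- What remains of a hook tableau once its arm is filled up to column p ∸ 1 and its leg up to row q ∸ 1.
record HookSuffix (p q : ℕ) (xs : List Cell) : Set where
  field
    arm-or-leg : ∀ i → (∃ λ c → List.lookup xs i ≡ (0 , c) × p ≤ c) ⊎ (∃ λ r → List.lookup xs i ≡ (r , 0) × q ≤ r)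
    arm-closed : ∀ i c → List.lookup xs i ≡ (0 , suc c) → p ≤ c → Precedes xs (toℕ i) (0 , c)
    leg-closed : ∀ i r → List.lookup xs i ≡ (suc r , 0) → q ≤ r → Precedes xs (toℕ i) (r , 0)
    injective : ∀ i j → List.lookup xs i ≡ List.lookup xs j → i ≡ j

HookSuffix-head : ∀ {p q y ys} → HookSuffix p q (y ∷ ys) → y ≡ (0 , p) ⊎ y ≡ (q , 0)
HookSuffix-head H with HookSuffix.arm-or-leg H fzero
... | inj₁ (c , refl , p≤c) with m≤n⇒m<n∨m≡n p≤c
...   | inj₂ refl = inj₁ refl
...   | inj₁ (s≤s {n = c'} p≤c') with () ← proj₁ (proj₂ (HookSuffix.arm-closed H fzero c' refl p≤c'))
HookSuffix-head H | inj₂ (r , refl , q≤r) with m≤n⇒m<n∨m≡n q≤r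
...   | inj₂ refl = inj₂ refl
...   | inj₁ (s≤s {n = r'} q≤r') with () ← proj₁ (proj₂ (HookSuffix.leg-closed H fzero r' refl q≤r'))

HookSuffix-arm : ∀ {p q ys} → 1 ≤ q → HookSuffix p q ((0 , p) ∷ ys) → HookSuffix (suc p) q ys
HookSuffix-arm {p} {q} {ys} 1≤q H = record
  { arm-or-leg = arm-or-leg
  ; arm-closed = λ i c e p<c → Precedes-tail (λ e' → <-irrefl (cong proj₂ e') p<c) (H.arm-closed (fsuc i) c e (<⇒≤ p<c))
  ; leg-closed = λ i r e q≤r →
      Precedes-tail (λ e' → <-irrefl (cong proj₁ e') (≤-trans 1≤q q≤r)) (H.leg-closed (fsuc i) r e q≤r)
  ; injective = λ i j e → Fin.suc-injective (H.injective (fsuc i) (fsuc j) e)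
  }
  where
  module H = HookSuffix H
  arm-or-leg : ∀ i → (∃ λ c → List.lookup ys i ≡ (0 , c) × suc p ≤ c) ⊎ (∃ λ r → List.lookup ys i ≡ (r , 0) × q ≤ r)
  arm-or-leg i with H.arm-or-leg (fsuc i)
  ... | inj₂ onLeg = inj₂ onLeg
  ... | inj₁ (c , e , p≤c) with m≤n⇒m<n∨m≡n p≤c
  ...   | inj₁ p<c = inj₁ (c , e , p<c)
  ...   | inj₂ refl with () ← H.injective (fsuc i) fzero e

HookSuffix-leg : ∀ {p q ys} → 1 ≤ p → HookSuffix p q ((q , 0) ∷ ys) → HookSuffix p (suc q) ys
HookSuffix-leg {p} {q} {ys} 1≤p H = record
  { arm-or-leg = arm-or-leg
  ; arm-closed = λ i c e p≤c →
      Precedes-tail (λ e' → <-irrefl (cong proj₂ e') (≤-trans 1≤p p≤c)) (H.arm-closed (fsuc i) c e p≤c)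
  ; leg-closed = λ i r e q<r → Precedes-tail (λ e' → <-irrefl (cong proj₁ e') q<r) (H.leg-closed (fsuc i) r e (<⇒≤ q<r))
  ; injective = λ i j e → Fin.suc-injective (H.injective (fsuc i) (fsuc j) e)
  }
  where
  module H = HookSuffix H
  arm-or-leg : ∀ i → (∃ λ c → List.lookup ys i ≡ (0 , c) × p ≤ c) ⊎ (∃ λ r → List.lookup ys i ≡ (r , 0) × suc q ≤ r)
  arm-or-leg i with H.arm-or-leg (fsuc i)
  ... | inj₁ onArm = inj₁ onArm
  ... | inj₂ (r , e , q≤r) with m≤n⇒m<n∨m≡n q≤r
  ...   | inj₁ q<r = inj₂ (r , e , q<r)
  ...   | inj₂ refl with () ← H.injective (fsuc i) fzero e

HookSuffix⇒hookCells : ∀ p q xs → 1 ≤ p → 1 ≤ q → HookSuffix p q xs → xs ≡ hookCells p q (List.map letterOf xs)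
HookSuffix⇒hookCells p q [] _ _ _ = refl
HookSuffix⇒hookCells p (suc q) (y ∷ ys) 1≤p 1≤q H with HookSuffix-head H
... | inj₁ refl = cong ((0 , p) ∷_) (HookSuffix⇒hookCells (suc p) (suc q) ys (m≤n⇒m≤1+n 1≤p) 1≤q (HookSuffix-arm 1≤q H))
... | inj₂ refl = cong ((suc q , 0) ∷_) (HookSuffix⇒hookCells p (suc (suc q)) ys 1≤p (s≤s z≤n) (HookSuffix-leg 1≤p H))

hook-corner : ∀ α β {n t₀ xs} → IsSYT (hookShape α β) n (t₀ ∷ xs) → t₀ ≡ (0 , 0)
hook-corner α β {t₀ = t₀} syt@(_ , inD , _) with InDiagram-hook⁻ α β t₀ (inD fzero)
... | inj₁ (zero , refl , _) = refl
... | inj₁ (suc c , refl , _)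
  with () ← proj₁ (proj₂ (standard-earlier (hookShape α β) syt fzero refl (s≤s z≤n) (inj₁ (refl , s≤s z≤n))))
... | inj₂ (r , refl , _)
  with () ← proj₁ (proj₂ (standard-earlier (hookShape α β) syt fzero refl (s≤s z≤n) (inj₂ (refl , s≤s z≤n))))

hook-suffix : ∀ α β {n t₀ xs} → IsSYT (hookShape α β) n (t₀ ∷ xs) → HookSuffix 1 1 xs
hook-suffix α β {t₀ = t₀} {xs} syt@(_ , inD , inj , _) = record
  { arm-or-leg = arm-or-leg
  ; arm-closed = arm-closed
  ; leg-closed = leg-closed
  ; injective = λ i j e → Fin.suc-injective (inj (fsuc i) (fsuc j) e)
  }
  where
  corner : t₀ ≡ (0 , 0)
  corner = hook-corner α β syt
  arm-or-leg : ∀ i → (∃ λ c → List.lookup xs i ≡ (0 , c) × 1 ≤ c) ⊎ (∃ λ r → List.lookup xs i ≡ (r , 0) × 1 ≤ r)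
  arm-or-leg i with InDiagram-hook⁻ α β _ (inD (fsuc i))
  ... | inj₁ (zero , e , _) with () ← inj (fsuc i) fzero (trans e (sym corner))
  ... | inj₁ (suc c , e , _) = inj₁ (suc c , e , s≤s z≤n)
  ... | inj₂ (r , e , _) = inj₂ (suc r , e , s≤s z≤n)
  arm-closed : ∀ i c → List.lookup xs i ≡ (0 , suc c) → 1 ≤ c → Precedes xs (toℕ i) (0 , c)
  arm-closed i c e 1≤c = Precedes-tail (λ e' → <-irrefl (cong proj₂ (trans (sym corner) e')) 1≤c)
    (standard-earlier (hookShape α β) syt (fsuc i) e
      (<-trans (n<1+n c) (subst (InDiagram (hookShape α β)) e (inD (fsuc i)))) (inj₁ (refl , ≤-refl)))
  leg-closed : ∀ i r → List.lookup xs i ≡ (suc r , 0) → 1 ≤ r → Precedes xs (toℕ i) (r , 0)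
  leg-closed i (suc r) e _ with InDiagram-hook⁻ α β (suc (suc r) , 0) (subst (InDiagram (hookShape α β)) e (inD (fsuc i)))
  ... | inj₂ (_ , refl , r+1<β) = Precedes-tail (λ e' → 1+n≢0 (sym (cong proj₁ (trans (sym corner) e'))))
    (standard-earlier (hookShape α β) syt (fsuc i) e (InDiagram-hook-leg α β r (<-trans (n<1+n r) r+1<β)) (inj₂ (refl , ≤-refl)))

arms≤ : ∀ α β w → All (InDiagram (hookShape α β)) (hookTableau w) → arms w ≤ α
arms≤ α β w inD with arms w in eq
... | zero = z≤n
... | suc c = ≤-pred (All.lookup inD (there (∈-hookCells-arm 1 1 w (suc c) (s≤s z≤n) (≤-reflexive (cong suc (sym eq))))))

legs≤ : ∀ α β w → All (InDiagram (hookShape α β)) (hookTableau w) → legs w ≤ β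
legs≤ α β w inD with legs w in eq
... | zero = z≤n
... | suc r =
  proj₂ (InDiagram-replicate⁻ β r 0 (All.lookup inD (there (∈-hookCells-leg 1 1 w (suc r) (s≤s z≤n) (≤-reflexive (cong suc (sym eq)))))))

+-≤-≡⇒≡ : ∀ {x y a b} → x ≤ a → y ≤ b → x + y ≡ a + b → x ≡ a × y ≡ b
+-≤-≡⇒≡ {x} {y} {a} {b} x≤a y≤b e = x≡a , +-cancelˡ-≡ a y b (trans (cong (_+ y) (sym x≡a)) e)
  where
  x≡a : x ≡ a
  x≡a = ≤-antisym x≤a (≮⇒≥ λ x<a → <-irrefl e (+-mono-<-≤ x<a y≤b))

SYT-hook⇒hookTableau : ∀ α β T → IsSYT (hookShape α β) (suc (α + β)) T →
  ∃ λ w → T ≡ hookTableau w × arms w ≡ α × legs w ≡ β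
SYT-hook⇒hookTableau α β (t₀ ∷ xs) syt@(len , inD , _) = w , T≡ , +-≤-≡⇒≡ (arms≤ α β w inD′) (legs≤ α β w inD′) size
  where
  w = List.map letterOf xs
  T≡ : t₀ ∷ xs ≡ hookTableau w
  T≡ = cong₂ _∷_ (hook-corner α β syt) (HookSuffix⇒hookCells 1 1 xs ≤-refl ≤-refl (hook-suffix α β syt))
  inD′ : All (InDiagram (hookShape α β)) (hookTableau w)
  inD′ = subst (All (InDiagram (hookShape α β))) T≡
    (All.tabulate λ x∈ → subst (InDiagram (hookShape α β)) (sym (Any.lookup-index x∈)) (inD (Any.index x∈)))
  size : arms w + legs w ≡ α + β
  size = trans (arms+legs w) (trans (List.length-map letterOf xs) (suc-injective len))

-- Evacuation of hook tableaux

findCell-sound : ∀ {k} x (v : Vec Cell k) {a} → findCell x v ≡ just a → Vec.lookup v a ≡ x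
findCell-sound x (y ∷ v) e with ≡-dec _≟_ _≟_ x y
... | yes x≡y with refl ← e = sym x≡y
... | no _ with findCell x v in e'
...   | just b with refl ← e = findCell-sound x v e'

findCell-complete : ∀ {k} x (v : Vec Cell k) i → Vec.lookup v i ≡ x → ∃ λ a → findCell x v ≡ just a
findCell-complete x (y ∷ v) i e with ≡-dec _≟_ _≟_ x y
... | yes _ = fzero , refl
findCell-complete x (y ∷ v) fzero e | no x≢y = ⊥-elim (x≢y (sym e))
findCell-complete x (y ∷ v) (fsuc i) e | no _ = Product.map fsuc (cong (Maybe.map fsuc)) (findCell-complete x v i e)

findCell-absent : ∀ {k} x (v : Vec Cell k) → (∀ i → Vec.lookup v i ≢ x) → findCell x v ≡ nothing
findCell-absent x [] _ = refl
findCell-absent x (y ∷ v) absent with ≡-dec _≟_ _≟_ x y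
... | yes x≡y = ⊥-elim (absent fzero (sym x≡y))
... | no _ = cong (Maybe.map fsuc) (findCell-absent x v (absent ∘ fsuc))

findCell-transpose : ∀ {k} x (v : Vec Cell k) → findCell (swap x) (Vec.map swap v) ≡ findCell x v
findCell-transpose x [] = refl
findCell-transpose x (y ∷ v) with ≡-dec _≟_ _≟_ (swap x) (swap y) | ≡-dec _≟_ _≟_ x y
... | yes _ | yes _ = refl
... | yes e | no x≢y = ⊥-elim (x≢y (cong swap e))
... | no x≢y | yes refl = ⊥-elim (x≢y refl)
... | no _ | no _ = cong (Maybe.map fsuc) (findCell-transpose x v)

-- When both neighbours of the hole are filled, slide compares two distinct indices, so the tie-break is symmetric.
slide-transpose : ∀ {k} f (h : Cell) (v : Vec Cell k) →
  slide f (swap h) (Vec.map swap v) ≡ Product.map (Vec.map swap) swap (slide f h v)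
slide-transpose-move : ∀ {k} f r c (v : Vec Cell k) a →
  slide f (Vec.lookup (Vec.map swap v) a) (Vec.map swap v [ a ]≔ (c , r))
    ≡ Product.map (Vec.map swap) swap (slide f (Vec.lookup v a) (v [ a ]≔ (r , c)))

slide-transpose zero h v = refl
slide-transpose (suc f) (r , c) v
  rewrite findCell-transpose (r , suc c) v | findCell-transpose (suc r , c) v
  with findCell (r , suc c) v in e₁ | findCell (suc r , c) v in e₂
... | nothing | nothing = refl
... | just a | nothing = slide-transpose-move f r c v a
... | nothing | just b = slide-transpose-move f r c v b
... | just a | just b
  with toℕ a <ᵇ toℕ b | <ᵇ-reflects-< (toℕ a) (toℕ b) | toℕ b <ᵇ toℕ a | <ᵇ-reflects-< (toℕ b) (toℕ a)
...   | true | ofʸ a<b | true | ofʸ b<a = ⊥-elim (<-asym a<b b<a)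
...   | true | _ | false | _ = slide-transpose-move f r c v a
...   | false | _ | true | _ = slide-transpose-move f r c v b
...   | false | ofⁿ a≮b | false | ofⁿ b≮a = ⊥-elim (1+n≢n (cong proj₁ same-cell))
  where
  same-cell : (suc r , c) ≡ (r , suc c)
  same-cell = trans (sym (findCell-sound _ v e₂))
    (trans (cong (Vec.lookup v) (Fin.toℕ-injective (≤-antisym (≮⇒≥ a≮b) (≮⇒≥ b≮a)))) (findCell-sound _ v e₁))

slide-transpose-move f r c v a
  rewrite Vec.lookup-map a swap v | sym (Vec.map-[]≔ {x = (r , c)} swap v a) = slide-transpose f (Vec.lookup v a) (v [ a ]≔ (r , c))

-- Once the hole has slid from (0 , 0) to (0 , c), the arm cells (0 , 1) … (0 , c) have moved one column left.
shiftArm : ℕ → Cell → Cell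
shiftArm c (zero , zero) = (zero , zero)
shiftArm c (zero , suc s) with s <? c
... | yes _ = (zero , s)
... | no _ = (zero , suc s)
shiftArm c (suc r , s) = (suc r , s)

shiftArm-next : ∀ c → shiftArm c (0 , suc c) ≡ (0 , suc c)
shiftArm-next c with c <? c
... | yes c<c = ⊥-elim (<-irrefl refl c<c)
... | no _ = refl

shiftArm-last : ∀ c → shiftArm (suc c) (0 , suc c) ≡ (0 , c)
shiftArm-last c with c <? suc c
... | yes _ = refl
... | no c≮1+c = ⊥-elim (c≮1+c ≤-refl)

shiftArm-suc : ∀ c y → y ≢ (0 , suc c) → shiftArm (suc c) y ≡ shiftArm c y
shiftArm-suc c (zero , zero) _ = refl
shiftArm-suc c (zero , suc s) y≢ with s <? suc c | s <? c
... | yes _ | yes _ = refl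
... | no _ | no _ = refl
... | yes s<1+c | no s≮c = ⊥-elim (y≢ (cong (λ t → 0 , suc t) (≤-antisym (≤-pred s<1+c) (≮⇒≥ s≮c))))
... | no s≮1+c | yes s<c = ⊥-elim (s≮1+c (m<n⇒m<1+n s<c))
shiftArm-suc c (suc r , s) _ = refl

shiftArm⁻¹-next : ∀ c y → shiftArm c y ≡ (0 , suc c) → y ≡ (0 , suc c)
shiftArm⁻¹-next c (zero , suc s) e with s <? c
... | yes s<c = ⊥-elim (<-asym s<c (subst (c <_) (sym (cong proj₂ e)) ≤-refl))
... | no _ = e

shiftArm⁻¹-leg : ∀ c y r s → shiftArm c y ≡ (suc r , s) → y ≡ (suc r , s)
shiftArm⁻¹-leg c (zero , suc s') r s e with s' <? c
shiftArm⁻¹-leg c (zero , suc s') r s () | yes _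
shiftArm⁻¹-leg c (zero , suc s') r s () | no _
shiftArm⁻¹-leg c (suc r' , s') r s e = e

module ArmSlide {k} (V : Vec Cell k) (N : ℕ)
  (distinct : ∀ i j → Vec.lookup V i ≡ Vec.lookup V j → i ≡ j)
  (no-inner : ∀ i r c → Vec.lookup V i ≢ (suc r , suc c))
  (arm-complete : ∀ c → c < N → ∃ λ i → Vec.lookup V i ≡ (0 , suc c))
  (arm-bounded : ∀ i c → Vec.lookup V i ≡ (0 , suc c) → c < N) where

  ShiftedBy : ℕ → Vec Cell k → Set
  ShiftedBy c W = ∀ i → Vec.lookup W i ≡ shiftArm c (Vec.lookup V i)

  nothing-below : ∀ c W → ShiftedBy (suc c) W → findCell (1 , suc c) W ≡ nothing
  nothing-below c W shifted = findCell-absent _ W λ i e →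
    no-inner i 0 c (shiftArm⁻¹-leg (suc c) _ 0 (suc c) (trans (sym (shifted i)) e))

  next-arm : ∀ c W → ShiftedBy (suc c) W → ∀ {i} → Vec.lookup W i ≡ (0 , suc (suc c)) → Vec.lookup V i ≡ (0 , suc (suc c))
  next-arm c W shifted e = shiftArm⁻¹-next (suc c) _ (trans (sym (shifted _)) e)

  shift-step : ∀ c W a → ShiftedBy (suc c) W → Vec.lookup V a ≡ (0 , suc (suc c)) →
    ShiftedBy (suc (suc c)) (W [ a ]≔ (0 , suc c))
  shift-step c W a shifted Va j with j Fin.≟ a
  ... | yes refl = trans (Vec.lookup∘update a W (0 , suc c)) (sym (trans (cong (shiftArm (suc (suc c))) Va) (shiftArm-last (suc c))))
  ... | no j≢a = trans (Vec.lookup∘update′ j≢a W _)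
        (trans (shifted j) (sym (shiftArm-suc (suc c) _ (λ e → j≢a (distinct j a (trans e (sym Va)))))))

  -- A hook has no cell (1 , 1 + c), so the hole is always refilled from its right.
  slide-along-arm : ∀ d c f W → ShiftedBy (suc c) W → d + suc c ≡ N → d ≤ f →
    ShiftedBy N (proj₁ (slide f (0 , suc c) W)) × proj₂ (slide f (0 , suc c) W) ≡ (0 , N)
  slide-along-arm zero c zero W shifted refl _ = shifted , refl
  slide-along-arm zero c (suc f) W shifted refl _
    rewrite findCell-absent (0 , suc (suc c)) W (λ i e → <-irrefl refl (arm-bounded i (suc c) (next-arm c W shifted e)))
          | nothing-below c W shifted = shifted , refl
  slide-along-arm (suc d) c (suc f) W shifted refl (s≤s d≤f)
    with arm-complete (suc c) (≤-trans (s≤s (s≤s (m≤n+m c d))) (≤-reflexive (sym (+-suc (suc d) c))))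
  ... | i , Vi
    with findCell-complete (0 , suc (suc c)) W i (trans (shifted i) (trans (cong (shiftArm (suc c)) Vi) (shiftArm-next (suc c))))
  ... | a , found rewrite found | nothing-below c W shifted | findCell-sound _ W found =
    slide-along-arm d (suc c) f (W [ a ]≔ (0 , suc c)) (shift-step c W a shifted (next-arm c W shifted (findCell-sound _ W found)))
      (+-suc d (suc c)) d≤f

hookCells-shiftArm : ∀ N p q w → p + arms w ≤ N → List.map (shiftArm N) (hookCells (suc p) (suc q) w) ≡ hookCells p (suc q) w
hookCells-shiftArm N p q [] _ = refl
hookCells-shiftArm N p q (arm ∷ w) p+w≤N with p <? N
... | yes _ = cong ((0 , p) ∷_) (hookCells-shiftArm N (suc p) q w (≤-trans (≤-reflexive (sym (+-suc p (arms w)))) p+w≤N))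
... | no p≮N = ⊥-elim (p≮N (≤-trans (≤-trans (m≤m+n (suc p) (arms w)) (≤-reflexive (sym (+-suc p (arms w))))) p+w≤N))
hookCells-shiftArm N p q (leg ∷ w) p+w≤N = cong ((suc q , 0) ∷_) (hookCells-shiftArm N p (suc q) w p+w≤N)

slide-corner-arm : ∀ {k} (V : Vec Cell k) → slide (suc k) (0 , 0) ((0 , 1) ∷ V) ≡ slide k (0 , 1) ((0 , 0) ∷ V)
slide-corner-arm V with findCell (1 , 0) V
... | nothing = refl
... | just _ = refl

slide-hook-arm : ∀ {k} (V : Vec Cell k) u → Vec.toList V ≡ hookCells 1 1 (arm ∷ u) →
  Vec.toList (proj₁ (slide k (0 , 0) V)) ≡ hookTableau u × proj₂ (slide k (0 , 0) V) ≡ (0 , suc (arms u))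
slide-hook-arm {suc k} (y ∷ V) u eq with List.∷-injective eq
... | refl , eqV rewrite slide-corner-arm V =
  trans (cong Vec.toList (Pointwise-≡⇒≡ (ext λ i → trans (proj₁ slid i) (sym (Vec.lookup-map i (shiftArm N) V₀)))))
    (trans (Vec.toList-map (shiftArm N) V₀) (trans (cong (List.map (shiftArm N)) eq) (hookCells-shiftArm N 0 0 (arm ∷ u) ≤-refl)))
  , proj₂ slid
  where
  V₀ = (0 , 1) ∷ V
  N = suc (arms u)
  open ArmSlide V₀ N
    (lookup-toList-injective V₀ eq (unique-hookCells 1 1 (arm ∷ u) ≤-refl ≤-refl))
    (lookup-toList-All V₀ eq (hookCells-no-inner 1 1 (arm ∷ u)))
    (λ c c<N → lookup-toList-∈ V₀ eq (∈-hookCells-arm 1 1 (arm ∷ u) (suc c) (s≤s z≤n) (s≤s c<N)))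
    (lookup-toList-All V₀ eq (hookCells-arm-bounded (arm ∷ u)))
  initial : ShiftedBy 1 ((0 , 0) ∷ V)
  initial fzero = refl
  initial (fsuc i) = lookup-toList-All V eqV (hookCells-All (λ y → y ≡ shiftArm 1 y) 2 1 u
    (λ { (suc (suc c)) _ _ → refl ; (suc zero) (s≤s ()) _ }) (λ { (suc r) _ _ → refl })) i
  fuel : arms u ≤ k
  fuel = ≤-trans (m≤m+n (arms u) (legs u)) (≤-reflexive
    (trans (arms+legs u) (trans (sym (length-hookCells 2 1 u)) (trans (cong length (sym eqV)) (Vec.length-toList V)))))
  slid = slide-along-arm (arms u) 0 k ((0 , 0) ∷ V) initial (+-comm (arms u) 1) fuel

slide-hook : ∀ {k} (V : Vec Cell k) x u → Vec.toList V ≡ hookCells 1 1 (x ∷ u) →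
  Vec.toList (proj₁ (slide k (0 , 0) V)) ≡ hookTableau u × proj₂ (slide k (0 , 0) V) ≡ newCell x u
slide-hook V arm u eq = slide-hook-arm V u eq
-- A leg slide is an arm slide of the transposed tableau.
slide-hook {k} V leg u eq = (begin
    Vec.toList (proj₁ (slide k (0 , 0) V))           ≡⟨ cong (Vec.toList ∘ proj₁) slide≡ ⟩
    Vec.toList (Vec.map swap (proj₁ transposed))     ≡⟨ Vec.toList-map swap (proj₁ transposed) ⟩
    List.map swap (Vec.toList (proj₁ transposed))    ≡⟨ cong (List.map swap) (proj₁ transposed-hook) ⟩
    List.map swap (hookTableau (List.map flip u))    ≡⟨ hookTableau-transpose (List.map flip u) ⟩
    hookTableau (List.map flip (List.map flip u))    ≡⟨ cong hookTableau (map-flip-involutive u) ⟩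
    hookTableau u                                    ∎)
  , trans (cong proj₂ slide≡) (cong swap (proj₂ transposed-hook))
  where
  open ≡-Reasoning
  Vᵀ = Vec.map swap V
  transposed = slide k (0 , 0) Vᵀ
  transposed-hook = slide-hook-arm Vᵀ (List.map flip u)
    (trans (Vec.toList-map swap V) (trans (cong (List.map swap) eq) (hookCells-transpose 1 1 (leg ∷ u))))
  slide≡ : slide k (0 , 0) V ≡ Product.map (Vec.map swap) swap transposed
  slide≡ = trans (cong (slide k (0 , 0)) (trans (sym (Vec.map-id V)) (Vec.map-∘ swap swap V))) (slide-transpose k (0 , 0) Vᵀ)

evac-hook : ∀ u {k} (V : Vec Cell k) → Vec.toList V ≡ hookTableau u → Vec.toList (evac k V) ≡ hookTableau (reverse u)
evac-hook [] (h ∷ []) refl = refl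
evac-hook (x ∷ u) {suc k} (h ∷ V) eq with List.∷-injective eq
... | refl , eqV with slide-hook V x u eqV
... | slid , hole = begin
  Vec.toList (evac k (proj₁ s) Vec.∷ʳ proj₂ s)    ≡⟨ Vec.toList-∷ʳ (proj₂ s) (evac k (proj₁ s)) ⟩
  Vec.toList (evac k (proj₁ s)) ++ [ proj₂ s ]
    ≡⟨ cong₂ (λ t c → t ++ [ c ]) (evac-hook u (proj₁ s) slid) (trans hole (sym (newCell-reverse x u))) ⟩
  hookTableau (reverse u) ++ [ newCell x (reverse u) ] ≡⟨ hookTableau-snoc (reverse u) x ⟨
  hookTableau (reverse u ++ [ x ])                 ≡⟨ cong hookTableau (List.unfold-reverse x u) ⟨
  hookTableau (reverse (x ∷ u))                    ∎
  where
  open ≡-Reasoning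
  s = slide k (0 , 0) V

schutz-hookTableau : ∀ j w → schutz j (hookTableau w) ≡ hookTableau (reversePrefix (j ∸ 1) w)
schutz-hookTableau zero w = refl
schutz-hookTableau (suc j) w = begin
  evacL ((0 , 0) ∷ take j (hookCells 1 1 w)) ++ drop j (hookCells 1 1 w)
    ≡⟨ cong₂ (λ t d → evacL ((0 , 0) ∷ t) ++ d) (hookCells-take j 1 1 w) (hookCells-drop j 1 1 w) ⟩
  evacL (hookTableau t) ++ hookCells (suc (arms t)) (suc (legs t)) (drop j w)
    ≡⟨ cong (_++ hookCells (suc (arms t)) (suc (legs t)) (drop j w))
         (evac-hook t (Vec.fromList (hookTableau t)) (Vec.toList∘fromList (hookTableau t))) ⟩
  hookTableau (reverse t) ++ hookCells (suc (arms t)) (suc (legs t)) (drop j w)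
    ≡⟨ cong₂ (λ a l → hookTableau (reverse t) ++ hookCells (suc a) (suc l) (drop j w)) (arms-reverse t) (legs-reverse t) ⟨
  (0 , 0) ∷ (hookCells 1 1 (reverse t) ++ hookCells (1 + arms (reverse t)) (1 + legs (reverse t)) (drop j w))
    ≡⟨ cong ((0 , 0) ∷_) (hookCells-++ 1 1 (reverse t) (drop j w)) ⟨
  hookTableau (reversePrefix j w) ∎
  where
  open ≡-Reasoning
  t = take j w

cactusAct-hookTableau : ∀ i j w → cactusAct i j (hookTableau w) ≡ hookTableau (cactusWord i j w)
cactusAct-hookTableau i j w
  rewrite schutz-hookTableau j w | schutz-hookTableau (j ∸ i + 1) (reversePrefix (j ∸ 1) w) | m+n∸n≡m (j ∸ i) 1 =
  schutz-hookTableau j _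

-- Orbits of pairs of hook tableaux

-- The k-th letter of a pair word locates the entry k + 2 in each of the two tableaux.
PairWord : Set
PairWord = List (Letter × Letter)

_≟²_ : DecidableEquality (Letter × Letter)
_≟²_ = ≡-dec _≟ᴸ_ _≟ᴸ_

open Multiplicity _≟²_

cells : PairWord → List Cell × List Cell
cells P = hookTableau (List.map proj₁ P) , hookTableau (List.map proj₂ P)

cells-injective : ∀ {P Q} → cells P ≡ cells Q → P ≡ Q
cells-injective e = map-proj-injective (hookTableau-injective (cong proj₁ e)) (hookTableau-injective (cong proj₂ e))

cactusAct-cells : ∀ i j P → (cactusAct i j (proj₁ (cells P)) , cactusAct i j (proj₂ (cells P))) ≡ cells (cactusWord i j P)
cactusAct-cells i j P = cong₂ _,_
  (trans (cactusAct-hookTableau i j _) (cong hookTableau (sym (map-cactusWord proj₁ i j P))))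
  (trans (cactusAct-hookTableau i j _) (cong hookTableau (sym (map-cactusWord proj₂ i j P))))

SameOrbit-cells : ∀ {n Z Y} → SameOrbit n Z Y → ∀ P → Z ≡ cells P → ∃ λ Q → Y ≡ cells Q × P ↭ Q
SameOrbit-cells ε P e = P , e , ↭-refl
SameOrbit-cells ((i , j , _ , _ , _ , refl , refl) ◅ rest) P refl with SameOrbit-cells rest (cactusWord i j P) (cactusAct-cells i j P)
... | Q , e , P′↭Q = Q , e , ↭-trans (↭-sym (cactusWord-↭ i j P)) P′↭Q

SameOrbit⇒↭ : ∀ {n P Q} → SameOrbit n (cells P) (cells Q) → P ↭ Q
SameOrbit⇒↭ {P = P} orbit with SameOrbit-cells orbit P refl
... | Q′ , e , P↭Q′ = subst (_ ↭_) (sym (cells-injective e)) P↭Q′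

AdjacentSwap⇒DiagStep : ∀ {n P Q} → suc (length P) ≡ n → AdjacentSwap P Q → DiagStep n (cells P) (cells Q)
AdjacentSwap⇒DiagStep refl (swap-at u x y v) =
  i , j , s≤s z≤n , s≤s (m<m+n (length u) (s≤s z≤n)) ,
  s≤s (≤-trans (+-monoʳ-≤ (length u) (s≤s (s≤s z≤n))) (≤-reflexive (sym (List.length-++ u)))) ,
  cong proj₁ (sym step) , cong proj₂ (sym step)
  where
  i = suc (length u)
  j = suc (length u + 2)
  step : (cactusAct i j (proj₁ (cells (u ++ x ∷ y ∷ v))) , cactusAct i j (proj₂ (cells (u ++ x ∷ y ∷ v))))
         ≡ cells (u ++ y ∷ x ∷ v)
  step = trans (cactusAct-cells i j (u ++ x ∷ y ∷ v)) (cong cells (cactusWord-reverses u (x ∷ y ∷ []) v))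

adjacent-swaps⇒SameOrbit : ∀ {n P Q} → suc (length P) ≡ n → Star AdjacentSwap P Q → SameOrbit n (cells P) (cells Q)
adjacent-swaps⇒SameOrbit len ε = ε
adjacent-swaps⇒SameOrbit len (s ◅ rest) =
  AdjacentSwap⇒DiagStep len s ◅ adjacent-swaps⇒SameOrbit (trans (cong suc (sym (AdjacentSwap-length s))) len) rest

↭⇒SameOrbit : ∀ {n P Q} → suc (length P) ≡ n → P ↭ Q → SameOrbit n (cells P) (cells Q)
↭⇒SameOrbit len P↭Q = adjacent-swaps⇒SameOrbit len (↭⇒adjacent-swaps P↭Q)

arms-proj₁ : ∀ P → arms (List.map proj₁ P) ≡ count (arm , arm) P + count (arm , leg) P
arms-proj₁ [] = refl
arms-proj₁ ((arm , arm) ∷ P) = cong suc (arms-proj₁ P)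
arms-proj₁ ((arm , leg) ∷ P) = trans (cong suc (arms-proj₁ P)) (sym (+-suc _ _))
arms-proj₁ ((leg , arm) ∷ P) = arms-proj₁ P
arms-proj₁ ((leg , leg) ∷ P) = arms-proj₁ P

legs-proj₁ : ∀ P → legs (List.map proj₁ P) ≡ count (leg , arm) P + count (leg , leg) P
legs-proj₁ [] = refl
legs-proj₁ ((arm , arm) ∷ P) = legs-proj₁ P
legs-proj₁ ((arm , leg) ∷ P) = legs-proj₁ P
legs-proj₁ ((leg , arm) ∷ P) = cong suc (legs-proj₁ P)
legs-proj₁ ((leg , leg) ∷ P) = trans (cong suc (legs-proj₁ P)) (sym (+-suc _ _))

arms-proj₂ : ∀ P → arms (List.map proj₂ P) ≡ count (arm , arm) P + count (leg , arm) P
arms-proj₂ [] = refl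
arms-proj₂ ((arm , arm) ∷ P) = cong suc (arms-proj₂ P)
arms-proj₂ ((leg , arm) ∷ P) = trans (cong suc (arms-proj₂ P)) (sym (+-suc _ _))
arms-proj₂ ((arm , leg) ∷ P) = arms-proj₂ P
arms-proj₂ ((leg , leg) ∷ P) = arms-proj₂ P

legs-proj₂ : ∀ P → legs (List.map proj₂ P) ≡ count (arm , leg) P + count (leg , leg) P
legs-proj₂ [] = refl
legs-proj₂ ((arm , arm) ∷ P) = legs-proj₂ P
legs-proj₂ ((leg , arm) ∷ P) = legs-proj₂ P
legs-proj₂ ((arm , leg) ∷ P) = cong suc (legs-proj₂ P)
legs-proj₂ ((leg , leg) ∷ P) = trans (cong suc (legs-proj₂ P)) (sym (+-suc _ _))

record Shapes (α₁ β₁ α₂ β₂ : ℕ) (P : PairWord) : Set where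
  field
    arms₁ : arms (List.map proj₁ P) ≡ α₁
    legs₁ : legs (List.map proj₁ P) ≡ β₁
    arms₂ : arms (List.map proj₂ P) ≡ α₂
    legs₂ : legs (List.map proj₂ P) ≡ β₂

Shapes-length : ∀ {α₁ β₁ α₂ β₂ P} → Shapes α₁ β₁ α₂ β₂ P → length P ≡ α₁ + β₁
Shapes-length {P = P} shapes = trans (sym (List.length-map proj₁ P))
  (trans (sym (arms+legs (List.map proj₁ P))) (cong₂ _+_ (Shapes.arms₁ shapes) (Shapes.legs₁ shapes)))

orbitIndex : PairWord → ℕ
orbitIndex P = count (leg , leg) P ⊓ count (arm , arm) P

orbitIndex-bound : ∀ {α₁ β₁ α₂ β₂ P} → Shapes α₁ β₁ α₂ β₂ P → orbitIndex P ≤ α₁ ⊓ β₁ ⊓ α₂ ⊓ β₂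
orbitIndex-bound {P = P} shapes =
  ⊓-glb (⊓-glb (⊓-glb (≤-trans (m⊓n≤n _ _) aa≤α₁) (≤-trans (m⊓n≤m _ _) ll≤β₁)) (≤-trans (m⊓n≤n _ _) aa≤α₂))
        (≤-trans (m⊓n≤m _ _) ll≤β₂)
  where
  open Shapes shapes
  aa≤α₁ = ≤-trans (m≤m+n _ _) (≤-reflexive (trans (sym (arms-proj₁ P)) arms₁))
  ll≤β₁ = ≤-trans (m≤n+m _ _) (≤-reflexive (trans (sym (legs-proj₁ P)) legs₁))
  aa≤α₂ = ≤-trans (m≤m+n _ _) (≤-reflexive (trans (sym (arms-proj₂ P)) arms₂))
  ll≤β₂ = ≤-trans (m≤n+m _ _) (≤-reflexive (trans (sym (legs-proj₂ P)) legs₂))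

orbitIndex≡⇒↭ : ∀ {α₁ β₁ α₂ β₂ P Q} → Shapes α₁ β₁ α₂ β₂ P → Shapes α₁ β₁ α₂ β₂ Q →
  orbitIndex P ≡ orbitIndex Q → P ↭ Q
orbitIndex≡⇒↭ {P = P} {Q} sP sQ same-index = count≡⇒↭ P Q same-count
  where
  module P = Shapes sP
  module Q = Shapes sQ
  table = table-determined
    (trans (sym (arms-proj₁ P)) (trans P.arms₁ (trans (sym Q.arms₁) (arms-proj₁ Q))))
    (trans (sym (arms-proj₂ P)) (trans P.arms₂ (trans (sym Q.arms₂) (arms-proj₂ Q))))
    (trans (sym (legs-proj₂ P)) (trans P.legs₂ (trans (sym Q.legs₂) (legs-proj₂ Q))))
    same-index
  same-count : ∀ x → count x P ≡ count x Q
  same-count (arm , arm) = proj₁ table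
  same-count (arm , leg) = proj₁ (proj₂ table)
  same-count (leg , arm) = proj₁ (proj₂ (proj₂ table))
  same-count (leg , leg) = proj₂ (proj₂ (proj₂ table))

↭⇒orbitIndex≡ : ∀ {P Q} → P ↭ Q → orbitIndex P ≡ orbitIndex Q
↭⇒orbitIndex≡ P↭Q = cong₂ _⊓_ (count-↭ P↭Q (leg , leg)) (count-↭ P↭Q (arm , arm))

letters² : List (Letter × Letter)
letters² = (arm , arm) ∷ (arm , leg) ∷ (leg , arm) ∷ (leg , leg) ∷ []

canonical : (Letter × Letter → ℕ) → PairWord
canonical t = List.concatMap (λ x → List.replicate (t x) x) letters²

count-canonical : ∀ t x → count x (canonical t) ≡ t x
count-canonical t x = trans (count-blocks t x letters²) (only x)
  where
  only : ∀ x → sum (List.map (λ y → if does (y ≟² x) then t y else 0) letters²) ≡ t x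
  only (arm , arm) = +-identityʳ _
  only (arm , leg) = +-identityʳ _
  only (leg , arm) = +-identityʳ _
  only (leg , leg) = +-identityʳ _

entries : ℕ → ℕ → ℕ → ℕ → Letter × Letter → ℕ
entries a b c d (arm , arm) = a
entries a b c d (arm , leg) = b
entries a b c d (leg , arm) = c
entries a b c d (leg , leg) = d

canonical-Shapes : ∀ a b c d {α₁ β₁ α₂ β₂} → a + b ≡ α₁ → c + d ≡ β₁ → a + c ≡ α₂ → b + d ≡ β₂ →
  Shapes α₁ β₁ α₂ β₂ (canonical (entries a b c d))
canonical-Shapes a b c d ab cd ac bd = record
  { arms₁ = trans (arms-proj₁ P) (trans (cong₂ _+_ (#P (arm , arm)) (#P (arm , leg))) ab)
  ; legs₁ = trans (legs-proj₁ P) (trans (cong₂ _+_ (#P (leg , arm)) (#P (leg , leg))) cd)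
  ; arms₂ = trans (arms-proj₂ P) (trans (cong₂ _+_ (#P (arm , arm)) (#P (leg , arm))) ac)
  ; legs₂ = trans (legs-proj₂ P) (trans (cong₂ _+_ (#P (arm , leg)) (#P (leg , leg))) bd)
  }
  where
  P = canonical (entries a b c d)
  #P = count-canonical (entries a b c d)

-- Counting the orbits

Fin-complete-invariant : ∀ {X : Set} (R : X → X → Set) M (g : X → ℕ) →
  (∀ x → g x < M) → (∀ k → k < M → ∃ λ x → g x ≡ k) → (∀ x y → (g x ≡ g y) ⇔ R x y) →
  Σ (X → Fin M) λ f → (∀ m → ∃ λ x → f x ≡ m) × (∀ x y → (f x ≡ f y) ⇔ R x y)
Fin-complete-invariant R M g bound onto classify = f , onto′ , λ x y → mk⇔
  (λ fx≡fy → Equivalence.to (classify x y) (trans (sym (toℕ-f x)) (trans (cong toℕ fx≡fy) (toℕ-f y))))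
  (λ Rxy → Fin.toℕ-injective (trans (toℕ-f x) (trans (Equivalence.from (classify x y) Rxy) (sym (toℕ-f y)))))
  where
  f : _ → Fin M
  f x = Fin.fromℕ< (bound x)
  toℕ-f : ∀ x → toℕ (f x) ≡ g x
  toℕ-f x = Fin.toℕ-fromℕ< (bound x)
  onto′ : ∀ m → ∃ λ x → f x ≡ m
  onto′ m with onto (toℕ m) (Fin.toℕ<n m)
  ... | x , gx≡m = x , Fin.toℕ-injective (trans (toℕ-f x) gx≡m)

module HookPairs (α₁ β₁ α₂ β₂ : ℕ) (size : α₁ + β₁ ≡ α₂ + β₂) where

  n = suc (α₁ + β₁)
  λ₁ = hookShape α₁ β₁
  λ₂ = hookShape α₂ β₂

  HookPair : Set
  HookPair = SYT λ₁ n × SYT λ₂ n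

  tableaux : HookPair → List Cell × List Cell
  tableaux = pairTab λ₁ λ₂ n

  pairWord : ∀ x → Σ PairWord λ P → tableaux x ≡ cells P × Shapes α₁ β₁ α₂ β₂ P
  pairWord ((T₁ , syt₁) , (T₂ , syt₂))
    with SYT-hook⇒hookTableau α₁ β₁ T₁ syt₁
       | SYT-hook⇒hookTableau α₂ β₂ T₂ (subst (λ m → IsSYT λ₂ m T₂) (cong suc size) syt₂)
  ... | w₁ , refl , a₁ , l₁ | w₂ , refl , a₂ , l₂ =
    List.zip w₁ w₂ , cong₂ _,_ (cong hookTableau (sym proj-w₁)) (cong hookTableau (sym proj-w₂)) ,
    record { arms₁ = trans (cong arms proj-w₁) a₁ ; legs₁ = trans (cong legs proj-w₁) l₁
           ; arms₂ = trans (cong arms proj-w₂) a₂ ; legs₂ = trans (cong legs proj-w₂) l₂ }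
    where
    same-length : length w₁ ≡ length w₂
    same-length = trans (sym (arms+legs w₁))
      (trans (cong₂ _+_ a₁ l₁) (trans size (trans (sym (cong₂ _+_ a₂ l₂)) (arms+legs w₂))))
    proj-w₁ = proj₁ (zip-proj w₁ w₂ same-length)
    proj-w₂ = proj₂ (zip-proj w₁ w₂ same-length)

  index : HookPair → ℕ
  index = orbitIndex ∘ proj₁ ∘ pairWord

  index-bound : ∀ x → index x ≤ α₁ ⊓ β₁ ⊓ α₂ ⊓ β₂
  index-bound x = orbitIndex-bound (proj₂ (proj₂ (pairWord x)))

  index-classifies : ∀ x y → (index x ≡ index y) ⇔ SameOrbit n (tableaux x) (tableaux y)
  index-classifies x y with pairWord x | pairWord y
  ... | P , x≡P , sP | Q , y≡Q , sQ = mk⇔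
    (λ same → subst₂ (SameOrbit n) (sym x≡P) (sym y≡Q)
      (↭⇒SameOrbit (cong suc (Shapes-length sP)) (orbitIndex≡⇒↭ sP sQ same)))
    (λ orbit → ↭⇒orbitIndex≡ (SameOrbit⇒↭ (subst₂ (SameOrbit n) x≡P y≡Q orbit)))

  index-onto : ∀ k → k ≤ α₁ ⊓ β₁ ⊓ α₂ ⊓ β₂ → ∃ λ x → index x ≡ k
  index-onto k k≤ with table-exists size k≤
  ... | a , b , c , d , ab , cd , ac , bd , d⊓a≡k = x , (begin
    index x     ≡⟨ cong orbitIndex (cells-injective (proj₁ (proj₂ (pairWord x)))) ⟨
    orbitIndex P ≡⟨ cong₂ _⊓_ (count-canonical t (leg , leg)) (count-canonical t (arm , arm)) ⟩
    d ⊓ a       ≡⟨ d⊓a≡k ⟩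
    k           ∎)
    where
    open ≡-Reasoning
    t = entries a b c d
    P = canonical t
    shapes = canonical-Shapes a b c d ab cd ac bd
    syt : ∀ {α β} w → arms w ≡ α → legs w ≡ β → IsSYT (hookShape α β) (suc (α + β)) (hookTableau w)
    syt w refl refl = hookTableau-SYT w
    x : HookPair
    x = (hookTableau (List.map proj₁ P) , syt (List.map proj₁ P) (Shapes.arms₁ shapes) (Shapes.legs₁ shapes))
      , (hookTableau (List.map proj₂ P) , subst (λ m → IsSYT λ₂ m (hookTableau (List.map proj₂ P))) (cong suc (sym size))
                                            (syt (List.map proj₂ P) (Shapes.arms₂ shapes) (Shapes.legs₂ shapes)))

mainTheorem7 : (n : ℕ) → 1 ≤ n → (l₁ l₂ : List ℕ) →
    IsPartition n l₁ → IsPartition n l₂ → IsHook l₁ → IsHook l₂ →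
    Σ (SYT l₁ n × SYT l₂ n → Fin (r₁ l₁ ⊓ c₁ l₁ ⊓ r₁ l₂ ⊓ c₁ l₂)) λ f →
      (∀ m → ∃ λ x → f x ≡ m)
      × (∀ x y → (f x ≡ f y) ⇔ SameOrbit n (pairTab l₁ l₂ n x) (pairTab l₁ l₂ n y))
mainTheorem7 n 1≤n l₁ l₂ partition₁ partition₂ hook₁ hook₂
  with hook-partition n l₁ 1≤n partition₁ hook₁ | hook-partition n l₂ 1≤n partition₂ hook₂
... | α₁ , β₁ , refl , refl | α₂ , β₂ , refl , size =
  Fin-complete-invariant _ _ index
    (λ x → subst (index x <_) (sym corners) (s≤s (index-bound x)))
    (λ k k< → index-onto k (≤-pred (subst (k <_) corners k<)))
    index-classifies
  where
  open HookPairs α₁ β₁ α₂ β₂ (suc-injective (sym size))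
  corners : r₁ λ₁ ⊓ c₁ λ₁ ⊓ r₁ λ₂ ⊓ c₁ λ₂ ≡ suc (α₁ ⊓ β₁ ⊓ α₂ ⊓ β₂)
  corners = cong₂ (λ c c′ → suc α₁ ⊓ c ⊓ suc α₂ ⊓ c′) (c₁-hookShape α₁ β₁) (c₁-hookShape α₂ β₂)
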